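{- Let $1\le k'\le k$ and $\ell\ge1$ be integers, and let $(D_1,\dots,D_k;f)$ be an $\ell$-bounded restricted digraph system on a common finite vertex set $V$. If $\alpha(D_i)\le\frac{|V|}{100^{k'}\ell^2}$ for all $i\in[k']$, then $(D_1,\dots,D_k;f)$ contains a proper rainbow directed path of length $k'$.
   Context: An edge-colouring of a digraph is proper if every vertex is incident to at most one out-edge and at most one in-edge of any given colour. An $\ell$-bounded restricted digraph system $(D_1,\dots,D_k;f)$ consists of properly edge-coloured digraphs $D_1,\dots,D_k$ on a common vertex set $V$ together with a function $f$ assigning to each $v\in V$ a set $f(v)$ of at most $\ell$ colours, with $f(u)\cap f(v)=\emptyset$ for distinct $u,v\in V$. A proper rainbow directed path of length $k'$ is a directed path $v_1,\dots,v_{k'+1}$ (distinct vertices) such that for all distinct $i,j\in[k']$: (1) $\vec{v_iv_{i+1}}\in E(D_i)$; (2) the colour of $\vec{v_iv_{i+1}}$ in $D_i$ differs from the colour of $\vec{v_jv_{j+1}}$ in $D_j$; (3) the colour of $\vec{v_iv_{i+1}}$ in $D_i$ is not in $f(v_1)\cup f(v_{k'+1})$. $\alpha(D)$ is the independence number of the underlying undirected graph of $D$. -}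

module Defs where

open import Data.Nat using (ℕ; suc; _≤_; _*_; _^_)
open import Data.Fin using (Fin; zero; suc; inject₁; fromℕ; inject≤)
open import Data.Maybe using (Maybe; just; nothing)
open import Data.List using (List; length)
open import Data.List.Membership.Propositional using (_∈_; _∉_)
open import Data.List.Relation.Unary.Unique.Propositional using (Unique)
open import Data.Product using (_×_; Σ; ∃)
open import Relation.Binary.PropositionalEquality using (_≡_; _≢_)
open import Function.Definitions using (Injective)

-- A digraph on vertex set Fin n whose edges carry colours in ℕ:
-- D u v ≡ just c  means the arc u→v is present with colour c,
-- D u v ≡ nothing means there is no arc u→v.
ColDigraph : ℕ → Set
ColDigraph n = Fin n → Fin n → Maybe ℕ

Loopless : ∀ {n} → ColDigraph n → Set
Loopless {n} D = (v : Fin n) → D v v ≡ nothing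

Proper : ∀ {n} → ColDigraph n → Set
Proper {n} D =
  ((u v w : Fin n) (c : ℕ) → D u v ≡ just c → D u w ≡ just c → v ≡ w) ×
  ((u v w : Fin n) (c : ℕ) → D v u ≡ just c → D w u ≡ just c → v ≡ w)

Independent : ∀ {n} → ColDigraph n → List (Fin n) → Set
Independent {n} D S = Unique S × ((x y : Fin n) → x ∈ S → y ∈ S → D x y ≡ nothing)

-- α(D) ≤ m / d  (for d > 0), i.e. every independent set S satisfies |S| * d ≤ m.
AlphaBound : ∀ {n} → ColDigraph n → (m d : ℕ) → Set
AlphaBound {n} D m d = (S : List (Fin n)) → Independent D S → length S * d ≤ m

IsRestriction : ∀ {n} → ℕ → (Fin n → List ℕ) → Set
IsRestriction {n} ℓ f =
  ((v : Fin n) → Unique (f v) × length (f v) ≤ ℓ) ×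
  ((u v : Fin n) (c : ℕ) → u ≢ v → c ∈ f u → c ∉ f v)

record RDS (n k ℓ : ℕ) : Set where
  field
    D         : Fin k → ColDigraph n
    loopless  : (i : Fin k) → Loopless (D i)
    proper    : (i : Fin k) → Proper (D i)
    f         : Fin n → List ℕ
    fBounded  : IsRestriction ℓ f

record ProperRainbowPath {n k ℓ : ℕ} (Sys : RDS n k ℓ) (k' : ℕ) (k'≤k : k' ≤ k) : Set where
  open RDS Sys
  field
    vtx      : Fin (suc k') → Fin n
    vtxDist  : Injective _≡_ _≡_ vtx
    col      : Fin k' → ℕ
    arc      : (i : Fin k') → D (inject≤ i k'≤k) (vtx (inject₁ i)) (vtx (suc i)) ≡ just (col i)
    colDist  : Injective _≡_ _≡_ col
    avoidFst : (i : Fin k') → col i ∉ f (vtx zero)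
    avoidLst : (i : Fin k') → col i ∉ f (vtx (fromℕ k'))

-- Build the paths backwards, one digraph at a time.  Let S be the set of vertices y that start a
-- proper rainbow path P(y) through the last m digraphs, and call x ∈ S stuck if no arc x → y of the
-- preceding digraph D, with y ∈ S, can be prepended to P(y).  Such an arc fails only if x lies on
-- P(y), its colour is a colour of P(y) or lies in f(end of P(y)) (then x is the tail of the unique arc
-- into y of that colour), its colour lies in f(x) (then y is the head of the unique arc out of x of
-- that colour), or a colour of P(y) lies in f(x) (then x is the unique owner of that colour).  So an
-- arc between stuck vertices joins x to one of at most Δ = 3m + 1 + 2ℓ "blockers" of y, or y to one
-- of x.  A relation in which every vertex has at most Δ in-neighbours is 2Δ-degenerate, hence the
-- stuck vertices contain an independent set of D of a (2Δ + 1)-th of their size, and the bound on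
-- α(D) loses at most (2Δ + 1)·|V|·100^(-k')·ℓ^(-2) vertices per step.  As k'(6k' + 4ℓ + 1) < 100^k' ℓ²,
-- some vertex survives all k' steps.
module Submission where

open import Defs
import Data.Nat
open import Data.Nat using (ℕ; zero; suc; _+_; _*_; _^_; _≤_; _<_; z≤n; s≤s; _≤?_; >-nonZero)
open import Data.Nat.Properties
open import Data.Nat.ListAction using (sum)
open import Data.Nat.Induction using (<-wellFounded)
open import Data.Nat.Tactic.RingSolver using (solve-∀)
open import Data.Fin using (Fin; zero; suc; inject₁; inject≤; fromℕ)
open import Data.Fin.Properties using (any?) renaming (_≟_ to _≟ᶠ_)
open import Data.Vec.Functional using (Vector; head; tail) renaming (_∷_ to _∷ᵛ_)
open import Data.Maybe using (Maybe; just; nothing)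
open import Data.Maybe.Properties using (≡-dec)
open import Data.List using (List; []; _∷_; length; map; filter; tabulate; mapMaybe; _++_; allFin)
open import Data.List.Properties using (length-catMaybes; length-map; length-++; length-tabulate; filter-notAll)
open import Data.List.Membership.Propositional using (_∈_; _∉_; find)
open import Data.List.Membership.Propositional.Properties using (∈-tabulate⁺; ∈-++⁺ˡ; ∈-++⁺ʳ; ∈-filter⁻)
open import Data.List.Relation.Unary.Any as Any using (Any; here; there)
open import Data.List.Relation.Unary.All as All using (All; []; _∷_)
open import Data.List.Relation.Unary.All.Properties using (¬Any⇒All¬)
open import Data.List.Relation.Unary.Unique.Propositional using (Unique; []; _∷_)
import Data.List.Relation.Unary.Unique.Propositional.Properties as Unique
open import Data.List.Relation.Binary.Subset.Propositional using (_⊆_)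
open import Data.Product using (Σ-syntax; ∃-syntax; _×_; _,_; proj₁; proj₂)
open import Data.Sum using (_⊎_; inj₁; inj₂; [_,_]′)
open import Data.Empty using (⊥-elim)
open import Function using (_∘_)
open import Function.Definitions using (Injective)
open import Induction.WellFounded using (Acc; acc)
open import Relation.Nullary using (¬_; Dec; yes; no; ¬?)
open import Relation.Nullary.Decidable using (decidable-stable; _⊎-dec_)
open import Relation.Unary using (Pred; Decidable)
open import Relation.Binary.Definitions using (DecidableEquality)
open import Relation.Binary.PropositionalEquality using (_≡_; _≢_; refl; sym; trans; cong; subst)
open import Algebra.Properties.CommutativeSemigroup +-commutativeSemigroup using (interchange)

module _ {a} {A : Set a} where

  sum-map-+ : (g h : A → ℕ) (xs : List A) →
              sum (map (λ x → g x + h x) xs) ≡ sum (map g xs) + sum (map h xs)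
  sum-map-+ g h []       = refl
  sum-map-+ g h (x ∷ xs) rewrite sum-map-+ g h xs = interchange (g x) (h x) _ _

  sum-map-mono : {g h : A → ℕ} {xs : List A} →
                 All (λ x → g x ≤ h x) xs → sum (map g xs) ≤ sum (map h xs)
  sum-map-mono []            = z≤n
  sum-map-mono (g≤h ∷ gs≤hs) = +-mono-≤ g≤h (sum-map-mono gs≤hs)

  sum-map-const : (c : ℕ) (xs : List A) → sum (map (λ _ → c) xs) ≡ length xs * c
  sum-map-const c []       = refl
  sum-map-const c (x ∷ xs) = cong (c +_) (sum-map-const c xs)

  sum-map-swap : (g : A → A → ℕ) (xs ys : List A) →
                 sum (map (λ y → sum (map (λ x → g x y) xs)) ys) ≡
                 sum (map (λ x → sum (map (λ y → g x y) ys)) xs)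
  sum-map-swap g []       ys = trans (sum-map-const 0 ys) (*-zeroʳ (length ys))
  sum-map-swap g (x ∷ xs) ys = trans (sum-map-+ (g x) _ ys) (cong (_ +_) (sum-map-swap g xs ys))

indicator : ∀ {p} {P : Set p} → Dec P → ℕ
indicator (yes _) = 1
indicator (no _)  = 0

module _ {a p q r} {A : Set a} {P : Pred A p} {Q : Pred A q} {R : Pred A r} where

  indicator-⊎ : (P? : Decidable P) (Q? : Decidable Q) (R? : Decidable R) →
                (∀ {x} → P x → Q x ⊎ R x) → ∀ x → indicator (P? x) ≤ indicator (Q? x) + indicator (R? x)
  indicator-⊎ P? Q? R? P⇒Q⊎R x with P? x | Q? x | R? x
  ... | no _  | _     | _     = z≤n
  ... | yes _ | yes _ | _     = s≤s z≤n
  ... | yes _ | no _  | yes _ = s≤s z≤n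
  ... | yes p | no ¬q | no ¬r with P⇒Q⊎R p
  ...   | inj₁ q = ⊥-elim (¬q q)
  ...   | inj₂ r = ⊥-elim (¬r r)

module _ {a p} {A : Set a} {P : Pred A p} (P? : Decidable P) where

  count : List A → ℕ
  count xs = sum (map (λ x → indicator (P? x)) xs)

  count-none : {xs : List A} → All (¬_ ∘ P) xs → count xs ≡ 0
  count-none []          = refl
  count-none {x ∷ _} (¬px ∷ ¬pxs) with P? x
  ... | yes px = ⊥-elim (¬px px)
  ... | no _   = count-none ¬pxs

  count≡length-filter : (xs : List A) → count xs ≡ length (filter P? xs)
  count≡length-filter []       = refl
  count≡length-filter (x ∷ xs) with P? x
  ... | yes _ = cong suc (count≡length-filter xs)
  ... | no _  = count≡length-filter xs

  length≡filter¬+count : (xs : List A) → length xs ≡ length (filter (¬? ∘ P?) xs) + count xs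
  length≡filter¬+count []       = refl
  length≡filter¬+count (x ∷ xs) with P? x
  ... | yes _ = trans (cong suc (length≡filter¬+count xs)) (sym (+-suc _ _))
  ... | no _  = cong suc (length≡filter¬+count xs)

module _ {a p q r} {A : Set a} {P : Pred A p} {Q : Pred A q} {R : Pred A r}
         (P? : Decidable P) (Q? : Decidable Q) (R? : Decidable R) where

  count-⊎ : (∀ {x} → P x → Q x ⊎ R x) → (xs : List A) → count P? xs ≤ count Q? xs + count R? xs
  count-⊎ P⇒Q⊎R xs = begin
    count P? xs                                                   ≤⟨ sum-map-mono (All.universal (indicator-⊎ P? Q? R? P⇒Q⊎R) xs) ⟩
    sum (map (λ x → indicator (Q? x) + indicator (R? x)) xs)     ≡⟨ sum-map-+ _ _ xs ⟩
    count Q? xs + count R? xs                                     ∎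
    where open ≤-Reasoning

module _ {a} {A : Set a} (_≟_ : DecidableEquality A) where

  open import Data.List.Membership.DecPropositional _≟_ using (_∈?_)

  Unique⇒count-≟≤1 : {xs : List A} → Unique xs → (y : A) → count (_≟ y) xs ≤ 1
  Unique⇒count-≟≤1 []            y = z≤n
  Unique⇒count-≟≤1 {x ∷ xs} (x∉xs ∷ uxs) y with x ≟ y
  ... | yes refl = s≤s (≤-reflexive (count-none (_≟ y) (All.map (λ y≢z z≡y → y≢z (sym z≡y)) x∉xs)))
  ... | no _     = Unique⇒count-≟≤1 uxs y

  Unique⇒count-∈≤length : {xs : List A} → Unique xs → (ys : List A) → count (_∈? ys) xs ≤ length ys
  Unique⇒count-∈≤length {xs} uxs []       = ≤-reflexive (count-none (_∈? []) (All.universal (λ _ ()) xs))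
  Unique⇒count-∈≤length {xs} uxs (y ∷ ys) =
    ≤-trans (count-⊎ (_∈? (y ∷ ys)) (_≟ y) (_∈? ys) head-or-tail xs)
            (+-mono-≤ (Unique⇒count-≟≤1 uxs y) (Unique⇒count-∈≤length uxs ys))
    where
      head-or-tail : ∀ {x} → x ∈ y ∷ ys → x ≡ y ⊎ x ∈ ys
      head-or-tail (here x≡y)  = inj₁ x≡y
      head-or-tail (there x∈) = inj₂ x∈

module BoundedInDegree {a} {A : Set a} (_≟_ : DecidableEquality A)
                       (N⁻ : A → List A) (Δ : ℕ) (N⁻-bounded : ∀ y → length (N⁻ y) ≤ Δ) where

  open import Data.List.Membership.DecPropositional _≟_ using (_∈?_)

  inDegree outDegree degree : List A → A → ℕ
  inDegree  S y = count (_∈? N⁻ y) S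
  outDegree S y = count (λ x → y ∈? N⁻ x) S
  degree    S y = inDegree S y + outDegree S y

  sum-degree≤ : {S : List A} → Unique S → sum (map (degree S) S) ≤ length S * (Δ + Δ)
  sum-degree≤ {S} uS = begin
    sum (map (degree S) S)                                    ≡⟨ sum-map-+ (inDegree S) (outDegree S) S ⟩
    sum (map (inDegree S) S) + sum (map (outDegree S) S)      ≡⟨ cong (sum (map (inDegree S) S) +_) (sum-map-swap (λ x y → indicator (y ∈? N⁻ x)) S S) ⟩
    sum (map (inDegree S) S) + sum (map (inDegree S) S)       ≤⟨ +-mono-≤ inDegrees≤ inDegrees≤ ⟩
    length S * Δ + length S * Δ                               ≡⟨ *-distribˡ-+ (length S) Δ Δ ⟨
    length S * (Δ + Δ)                                        ∎
    where
      open ≤-Reasoning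
      inDegrees≤ : sum (map (inDegree S) S) ≤ length S * Δ
      inDegrees≤ = ≤-trans (sum-map-mono (All.universal (λ y → ≤-trans (Unique⇒count-∈≤length _≟_ uS (N⁻ y)) (N⁻-bounded y)) S))
                           (≤-reflexive (sum-map-const Δ S))

  lowDegreeVertex : {x : A} {S : List A} → Unique (x ∷ S) →
                    ∃[ y ] y ∈ x ∷ S × degree (x ∷ S) y ≤ Δ + Δ
  lowDegreeVertex {x} {S} uL with Any.any? (λ y → degree (x ∷ S) y ≤? Δ + Δ) (x ∷ S)
  ... | yes low = find low
  ... | no ¬low = ⊥-elim (<⇒≱ sum> (sum-degree≤ uL))
    where
      L = x ∷ S
      sum> : length L * (Δ + Δ) < sum (map (degree L) L)
      sum> = begin-strict
        length L * (Δ + Δ)              <⟨ *-monoʳ-< (length L) (n<1+n (Δ + Δ)) ⟩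
        length L * suc (Δ + Δ)          ≡⟨ sum-map-const (suc (Δ + Δ)) L ⟨
        sum (map (λ _ → suc (Δ + Δ)) L) ≤⟨ sum-map-mono (All.map ≰⇒> (¬Any⇒All¬ L ¬low)) ⟩
        sum (map (degree L) L)          ∎
        where open ≤-Reasoning

  Near : A → A → Set a
  Near y x = x ≡ y ⊎ x ∈ N⁻ y ⊎ y ∈ N⁻ x

  near? : (y : A) → Decidable (Near y)
  near? y x = (x ≟ y) ⊎-dec (x ∈? N⁻ y) ⊎-dec (y ∈? N⁻ x)

  count-near≤1+degree : {L : List A} → Unique L → (y : A) → count (near? y) L ≤ suc (degree L y)
  count-near≤1+degree {L} uL y = begin
    count (near? y) L                                           ≤⟨ count-⊎ (near? y) (_≟ y) _ (λ near → near) L ⟩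
    count (_≟ y) L + count (λ x → (x ∈? N⁻ y) ⊎-dec (y ∈? N⁻ x)) L
      ≤⟨ +-mono-≤ (Unique⇒count-≟≤1 _≟_ uL y) (count-⊎ _ (_∈? N⁻ y) (λ x → y ∈? N⁻ x) (λ adj → adj) L) ⟩
    suc (degree L y)                                            ∎
    where open ≤-Reasoning

  Anticlique : List A → Set a
  Anticlique I = ∀ {x y} → x ∈ I → y ∈ I → x ≢ y → x ∉ N⁻ y

  record LargeAnticlique (S : List A) : Set a where
    field
      I          : List A
      unique     : Unique I
      I⊆S        : I ⊆ S
      anticlique : Anticlique I
      large      : length S ≤ suc (Δ + Δ) * length I

  largeAnticlique : (S : List A) → Unique S → LargeAnticlique S
  largeAnticlique S = go S (<-wellFounded (length S))
    where
      go : (S : List A) → Acc _<_ (length S) → Unique S → LargeAnticlique S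
      go []      _        _  = record { I = [] ; unique = [] ; I⊆S = λ () ; anticlique = λ () ; large = z≤n }
      go (x ∷ S) (acc rec) uL with lowDegreeVertex uL
      ... | y , y∈L , y-low = record
        { I          = y ∷ I
        ; unique     = All.tabulate (λ z∈I y≡z → far z∈I (inj₁ (sym y≡z))) ∷ unique
        ; I⊆S        = λ { (here refl) → y∈L ; (there z∈I) → proj₁ (∈-filter⁻ keep? (I⊆S z∈I)) }
        ; anticlique = anticlique′
        ; large      = large′
        }
        where
          L = x ∷ S
          keep? = ¬? ∘ near? y
          L′ = filter keep? L
          shorter : length L′ < length L
          shorter = filter-notAll keep? L (Any.map (λ { refl keep → keep (inj₁ refl) }) y∈L)
          open LargeAnticlique (go L′ (rec shorter) (Unique.filter⁺ keep? uL))
          far : ∀ {z} → z ∈ I → ¬ Near y z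
          far z∈I = proj₂ (∈-filter⁻ keep? (I⊆S z∈I))
          anticlique′ : Anticlique (y ∷ I)
          anticlique′ (here refl) (here refl) y≢y = ⊥-elim (y≢y refl)
          anticlique′ (here refl) (there v∈I) _   = λ y∈ → far v∈I (inj₂ (inj₂ y∈))
          anticlique′ (there u∈I) (here refl) _   = λ u∈ → far u∈I (inj₂ (inj₁ u∈))
          anticlique′ (there u∈I) (there v∈I)     = anticlique u∈I v∈I
          large′ : length L ≤ suc (Δ + Δ) * length (y ∷ I)
          large′ = begin
            length L                                   ≡⟨ length≡filter¬+count (near? y) L ⟩
            length L′ + count (near? y) L              ≤⟨ +-mono-≤ large (≤-trans (count-near≤1+degree uL y) (s≤s y-low)) ⟩
            suc (Δ + Δ) * length I + suc (Δ + Δ)       ≡⟨ trans (*-suc (suc (Δ + Δ)) (length I)) (+-comm (suc (Δ + Δ)) _) ⟨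
            suc (Δ + Δ) * length (y ∷ I)               ∎
            where open ≤-Reasoning

module _ {a} {A : Set a} where

  injective-∷ : ∀ {m} {x : A} {xs : Vector A m} →
                (∀ t → xs t ≢ x) → Injective _≡_ _≡_ xs → Injective _≡_ _≡_ (x ∷ᵛ xs)
  injective-∷ x∉xs inj {zero}  {zero}  _  = refl
  injective-∷ x∉xs inj {zero}  {suc j} eq = ⊥-elim (x∉xs j (sym eq))
  injective-∷ x∉xs inj {suc i} {zero}  eq = ⊥-elim (x∉xs i eq)
  injective-∷ x∉xs inj {suc i} {suc j} eq = cong suc (inj eq)

  length-++-≤ : ∀ xs {ys : List A} {k l} → length xs ≤ k → length ys ≤ l → length (xs ++ ys) ≤ k + l
  length-++-≤ xs xs≤ ys≤ = ≤-trans (≤-reflexive (length-++ xs)) (+-mono-≤ xs≤ ys≤)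

module _ {a b} {A : Set a} {B : Set b} {g : A → Maybe B} where

  ∈-mapMaybe⁺ : ∀ {c cs x} → c ∈ cs → g c ≡ just x → x ∈ mapMaybe g cs
  ∈-mapMaybe⁺ (here refl) gc≡x rewrite gc≡x = here refl
  ∈-mapMaybe⁺ {cs = c′ ∷ _} (there c∈cs) gc≡x with g c′
  ... | just _  = there (∈-mapMaybe⁺ c∈cs gc≡x)
  ... | nothing = ∈-mapMaybe⁺ c∈cs gc≡x

  length-mapMaybe : (cs : List A) → length (mapMaybe g cs) ≤ length cs
  length-mapMaybe cs = ≤-trans (length-catMaybes (map g cs)) (≤-reflexive (length-map g cs))

module _ {n p} {P : Pred (Fin n) p} (P? : Decidable P) where

  uniqueWitness : Maybe (Fin n)
  uniqueWitness with any? P?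
  ... | yes (x , _) = just x
  ... | no _        = nothing

  uniqueWitness-complete : (∀ {x y} → P x → P y → x ≡ y) → ∀ {x} → P x → uniqueWitness ≡ just x
  uniqueWitness-complete unique {x} px with any? P?
  ... | yes (y , py) = cong just (unique py px)
  ... | no ¬∃        = ⊥-elim (¬∃ (x , px))

record Walk (n m : ℕ) : Set where
  constructor walk
  field
    vertex : Vector (Fin n) (suc m)
    colour : Vector ℕ m

  start end : Fin n
  start = vertex zero
  end   = vertex (fromℕ m)

open Walk

prepend : ∀ {n m} → Fin n → ℕ → Walk n m → Walk n (suc m)
prepend u c W = walk (u ∷ᵛ vertex W) (c ∷ᵛ colour W)

module RainbowPaths {n : ℕ} (f : Fin n → List ℕ) where

  open import Data.List.Membership.DecPropositional Data.Nat._≟_ using (_∈?_)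

  record IsRainbowPath {m} (Ds : Vector (ColDigraph n) m) (W : Walk n m) : Set where
    field
      vertex-injective : Injective _≡_ _≡_ (vertex W)
      arc              : ∀ t → Ds t (vertex W (inject₁ t)) (vertex W (suc t)) ≡ just (colour W t)
      colour-injective : Injective _≡_ _≡_ (colour W)
      avoidStart       : ∀ t → colour W t ∉ f (start W)
      avoidEnd         : ∀ t → colour W t ∉ f (end W)

  trivialPath : (y : Fin n) → Walk n 0
  trivialPath y = walk (λ _ → y) (λ ())

  trivialPath-rainbow : (Ds : Vector (ColDigraph n) 0) → ∀ y → IsRainbowPath Ds (trivialPath y)
  trivialPath-rainbow Ds y = record
    { vertex-injective = λ { {zero} {zero} _ → refl }
    ; arc              = λ ()
    ; colour-injective = λ { {()} }
    ; avoidStart       = λ ()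
    ; avoidEnd         = λ ()
    }

  forbiddenColours : ∀ {m} → Walk n m → List ℕ
  forbiddenColours W = tabulate (colour W) ++ f (end W)

  data Obstruction {m} (u : Fin n) (c : ℕ) (W : Walk n m) : Set where
    revisit         : ∀ t → vertex W t ≡ u → Obstruction u c W
    forbiddenColour : c ∈ forbiddenColours W → Obstruction u c W
    ownColour       : c ∈ f u → Obstruction u c W
    ownedColour     : ∀ t → colour W t ∈ f u → Obstruction u c W

  prepend-rainbow : ∀ {m} {Ds : Vector (ColDigraph n) (suc m)} {W u c} →
                    IsRainbowPath (tail Ds) W → head Ds u (start W) ≡ just c → ¬ Obstruction u c W →
                    IsRainbowPath Ds (prepend u c W)
  prepend-rainbow {W = W} {u} {c} path u→start ¬obstruction = record
    { vertex-injective = injective-∷ (λ t → ¬obstruction ∘ revisit t) vertex-injective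
    ; arc              = λ { zero → u→start ; (suc t) → arc t }
    ; colour-injective = injective-∷ (λ t eq → ¬obstruction (forbiddenColour (subst (_∈ _) eq (usedColour t))))
                                     colour-injective
    ; avoidStart       = λ { zero → ¬obstruction ∘ ownColour ; (suc t) → ¬obstruction ∘ ownedColour t }
    ; avoidEnd         = λ { zero → ¬obstruction ∘ forbiddenColour ∘ ∈-++⁺ʳ (tabulate (colour W)) ; (suc t) → avoidEnd t }
    }
    where
      open IsRainbowPath path
      usedColour : ∀ t → colour W t ∈ forbiddenColours W
      usedColour t = ∈-++⁺ˡ (∈-tabulate⁺ {f = colour W} t)

  obstruction? : ∀ {m} u c (W : Walk n m) → Dec (Obstruction u c W)
  obstruction? u c W
    with any? (λ t → vertex W t ≟ᶠ u) | c ∈? forbiddenColours W | c ∈? f u | any? (λ t → colour W t ∈? f u)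
  ... | yes (t , eq) | _     | _     | _            = yes (revisit t eq)
  ... | no _         | yes i | _     | _            = yes (forbiddenColour i)
  ... | no _         | no _  | yes i | _            = yes (ownColour i)
  ... | no _         | no _  | no _  | yes (t , i)  = yes (ownedColour t i)
  ... | no ¬r        | no ¬f | no ¬o | no ¬d        = no λ
    { (revisit t eq) → ¬r (t , eq) ; (forbiddenColour i) → ¬f i ; (ownColour i) → ¬o i ; (ownedColour t i) → ¬d (t , i) }

  record RainbowStarts {m} (Ds : Vector (ColDigraph n) m) : Set where
    field
      starts           : List (Fin n)
      unique           : Unique starts
      pathFrom         : Fin n → Walk n m
      pathFrom-rainbow : ∀ {y} → y ∈ starts → IsRainbowPath Ds (pathFrom y)
      pathFrom-start   : ∀ {y} → y ∈ starts → start (pathFrom y) ≡ y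

  trivialStarts : (Ds : Vector (ColDigraph n) 0) → RainbowStarts Ds
  trivialStarts Ds = record
    { starts           = allFin n
    ; unique           = Unique.allFin⁺ n
    ; pathFrom         = trivialPath
    ; pathFrom-rainbow = λ {y} _ → trivialPath-rainbow Ds y
    ; pathFrom-start   = λ _ → refl
    }

  module Extension {ℓ} (restriction : IsRestriction ℓ f)
                   {m} (Ds : Vector (ColDigraph n) (suc m)) (proper : Proper (head Ds))
                   (L : RainbowStarts (tail Ds)) where

    open RainbowStarts L
    D = head Ds

    Extends : Fin n → Fin n → Set
    Extends u y = ∃[ c ] D u y ≡ just c × ¬ Obstruction u c (pathFrom y)

    extends? : ∀ u y → Dec (Extends u y)
    extends? u y with D u y
    ... | nothing = no λ { (_ , () , _) }
    ... | just c with obstruction? u c (pathFrom y)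
    ...   | yes o  = no λ { (_ , refl , ¬o) → ¬o o }
    ...   | no ¬o  = yes (c , refl , ¬o)

    Extendable : Fin n → Set
    Extendable u = Any (Extends u) starts

    extendable? : Decidable Extendable
    extendable? u = Any.any? (extends? u) starts

    extendedPath : ∀ {u} → Dec (Extendable u) → Walk n (suc m)
    extendedPath {u} (yes e) = let y , _ , c , _ = find e in prepend u c (pathFrom y)
    extendedPath {u} (no _)  = walk (λ _ → u) (λ _ → 0)  -- never used: such u are filtered out below

    extendedPath-rainbow : ∀ {u} (e? : Dec (Extendable u)) → Extendable u → IsRainbowPath Ds (extendedPath e?)
    extendedPath-rainbow {u} (yes e) _ =
      let y , y∈ , c , u→y , ¬obstruction = find e
      in  prepend-rainbow (pathFrom-rainbow y∈) (subst (λ v → D u v ≡ just c) (sym (pathFrom-start y∈)) u→y) ¬obstruction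
    extendedPath-rainbow (no ¬e) e = ⊥-elim (¬e e)

    extended : RainbowStarts Ds
    extended = record
      { starts           = filter extendable? starts
      ; unique           = Unique.filter⁺ extendable? unique
      ; pathFrom         = λ u → extendedPath (extendable? u)
      ; pathFrom-rainbow = λ {u} u∈ → extendedPath-rainbow (extendable? u) (proj₂ (∈-filter⁻ extendable? {xs = starts} u∈))
      ; pathFrom-start   = λ {u} _ → extendedPath-start (extendable? u)
      }
      where
        extendedPath-start : ∀ {u} (e? : Dec (Extendable u)) → start (extendedPath e?) ≡ u
        extendedPath-start (yes _) = refl
        extendedPath-start (no _)  = refl

    _≟ᴹ_ : (a b : Maybe ℕ) → Dec (a ≡ b)
    _≟ᴹ_ = ≡-dec Data.Nat._≟_

    tailInto : Fin n → ℕ → Maybe (Fin n)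
    tailInto y c = uniqueWitness (λ x → D x y ≟ᴹ just c)

    headFrom : Fin n → ℕ → Maybe (Fin n)
    headFrom x c = uniqueWitness (λ y → D x y ≟ᴹ just c)

    owner : ℕ → Maybe (Fin n)
    owner c = uniqueWitness (λ x → c ∈? f x)

    pathVertices tailsOfForbidden headsOfOwnColours ownersOfPathColours blockers : Fin n → List (Fin n)
    pathVertices        y = tabulate (vertex (pathFrom y))
    tailsOfForbidden    y = mapMaybe (tailInto y) (forbiddenColours (pathFrom y))
    headsOfOwnColours   y = mapMaybe (headFrom y) (f y)
    ownersOfPathColours y = mapMaybe owner (tabulate (colour (pathFrom y)))
    blockers            y = pathVertices y ++ tailsOfForbidden y ++ headsOfOwnColours y ++ ownersOfPathColours y

    blockers-length : ∀ y → length (blockers y) ≤ suc (3 * m + 2 * ℓ)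
    blockers-length y = begin
      length (blockers y)
        ≤⟨ length-++-≤ (pathVertices y) (≤-reflexive (length-tabulate (vertex W)))
           (length-++-≤ (tailsOfForbidden y)
              (≤-trans (length-mapMaybe (forbiddenColours W))
                       (length-++-≤ (tabulate (colour W)) (≤-reflexive (length-tabulate (colour W))) (f-bounded (end W))))
           (length-++-≤ (headsOfOwnColours y) (≤-trans (length-mapMaybe (f y)) (f-bounded y))
                        (≤-trans (length-mapMaybe (tabulate (colour W))) (≤-reflexive (length-tabulate (colour W)))))) ⟩
      suc m + ((m + ℓ) + (ℓ + m))   ≡⟨ arithmetic m ℓ ⟩
      suc (3 * m + 2 * ℓ)           ∎
      where
        open ≤-Reasoning
        W = pathFrom y
        f-bounded : ∀ v → length (f v) ≤ ℓ
        f-bounded v = proj₂ (proj₁ restriction v)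
        arithmetic : ∀ m ℓ → suc m + ((m + ℓ) + (ℓ + m)) ≡ suc (3 * m + 2 * ℓ)
        arithmetic = solve-∀

    tailInto-complete : ∀ {x y c} → D x y ≡ just c → tailInto y c ≡ just x
    tailInto-complete {y = y} {c} = uniqueWitness-complete _ (proj₂ proper y _ _ c)

    headFrom-complete : ∀ {x y c} → D x y ≡ just c → headFrom x c ≡ just y
    headFrom-complete {x} {c = c} = uniqueWitness-complete _ (proj₁ proper x _ _ c)

    owner-complete : ∀ {x c} → c ∈ f x → owner c ≡ just x
    owner-complete {c = c} = uniqueWitness-complete _ λ {x} {x′} c∈fx c∈fx′ →
      decidable-stable (x ≟ᶠ x′) (λ x≢x′ → proj₂ restriction x x′ c x≢x′ c∈fx c∈fx′)

    conflict : ∀ {x y c} → D x y ≡ just c → Obstruction x c (pathFrom y) → x ∈ blockers y ⊎ y ∈ blockers x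
    conflict {y = y} x→y (revisit t eq) =
      inj₁ (∈-++⁺ˡ (subst (_∈ pathVertices y) eq (∈-tabulate⁺ {f = vertex (pathFrom y)} t)))
    conflict {y = y} x→y (forbiddenColour c∈) =
      inj₁ (∈-++⁺ʳ (pathVertices y) (∈-++⁺ˡ (∈-mapMaybe⁺ c∈ (tailInto-complete x→y))))
    conflict {x} x→y (ownColour c∈) =
      inj₂ (∈-++⁺ʳ (pathVertices x) (∈-++⁺ʳ (tailsOfForbidden x) (∈-++⁺ˡ (∈-mapMaybe⁺ c∈ (headFrom-complete x→y)))))
    conflict {y = y} x→y (ownedColour t c∈) =
      inj₁ (∈-++⁺ʳ (pathVertices y) (∈-++⁺ʳ (tailsOfForbidden y) (∈-++⁺ʳ (headsOfOwnColours y)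
             (∈-mapMaybe⁺ (∈-tabulate⁺ {f = colour (pathFrom y)} t) (owner-complete c∈)))))

    module _ (loopless : Loopless D) {d Δ : ℕ} (sparse : AlphaBound D n d)
             (Δ-bound : suc (3 * m + 2 * ℓ) ≤ Δ) where

      open BoundedInDegree _≟ᶠ_ blockers Δ (λ y → ≤-trans (blockers-length y) Δ-bound)

      stuck : List (Fin n)
      stuck = filter (¬? ∘ extendable?) starts

      anticlique⇒independent : ∀ {I} → Unique I → I ⊆ stuck → Anticlique I → Independent D I
      anticlique⇒independent {I} uI I⊆stuck anticlique = uI , noArc
        where
          noArc : ∀ x y → x ∈ I → y ∈ I → D x y ≡ nothing
          noArc x y x∈I y∈I with x ≟ᶠ y
          ... | yes refl = loopless x
          ... | no x≢y with D x y in x→y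
          ...   | nothing = refl
          ...   | just c  = ⊥-elim ([ anticlique x∈I y∈I x≢y , anticlique y∈I x∈I (x≢y ∘ sym) ]′ (conflict x→y obstruction))
            where
              x-stuck : ¬ Extendable x
              x-stuck = proj₂ (∈-filter⁻ (¬? ∘ extendable?) {xs = starts} (I⊆stuck x∈I))
              y-start : y ∈ starts
              y-start = proj₁ (∈-filter⁻ (¬? ∘ extendable?) {xs = starts} (I⊆stuck y∈I))
              obstruction : Obstruction x c (pathFrom y)
              obstruction = decidable-stable (obstruction? x c (pathFrom y))
                              (λ ¬o → x-stuck (Any.map (λ { refl → c , x→y , ¬o }) y-start))

      stuck-small : length stuck * d ≤ suc (Δ + Δ) * n
      stuck-small = begin
        length stuck * d                 ≤⟨ *-monoˡ-≤ d large ⟩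
        suc (Δ + Δ) * length I * d       ≡⟨ *-assoc (suc (Δ + Δ)) (length I) d ⟩
        suc (Δ + Δ) * (length I * d)     ≤⟨ *-monoʳ-≤ (suc (Δ + Δ)) (sparse I (anticlique⇒independent I-unique I⊆S I-anticlique)) ⟩
        suc (Δ + Δ) * n                  ∎
        where
          open ≤-Reasoning
          open LargeAnticlique (largeAnticlique stuck (Unique.filter⁺ (¬? ∘ extendable?) unique))
            renaming (unique to I-unique; anticlique to I-anticlique)

      extended-large : length starts * d ≤ length (RainbowStarts.starts extended) * d + suc (Δ + Δ) * n
      extended-large = begin
        length starts * d                                   ≡⟨ cong (_* d) (length≡filter¬+count extendable? starts) ⟩
        (length stuck + count extendable? starts) * d       ≡⟨ cong (λ k → (length stuck + k) * d) (count≡length-filter extendable? starts) ⟩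
        (length stuck + length extendedStarts) * d          ≡⟨ *-distribʳ-+ d (length stuck) (length extendedStarts) ⟩
        length stuck * d + length extendedStarts * d        ≤⟨ +-monoˡ-≤ _ stuck-small ⟩
        suc (Δ + Δ) * n + length extendedStarts * d         ≡⟨ +-comm (suc (Δ + Δ) * n) _ ⟩
        length extendedStarts * d + suc (Δ + Δ) * n         ∎
        where
          open ≤-Reasoning
          extendedStarts = RainbowStarts.starts extended

  module _ {ℓ} (restriction : IsRestriction ℓ f) {d Δ : ℕ} where

    step-bound : ∀ m → 3 * suc m + 2 * ℓ ≤ Δ → suc (3 * m + 2 * ℓ) ≤ Δ
    step-bound m bound = ≤-trans (s≤s (m≤n+m _ 2)) (≤-trans (≤-reflexive (sym (3*[1+m]+2ℓ m ℓ))) bound)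
      where
        3*[1+m]+2ℓ : ∀ m ℓ → 3 * suc m + 2 * ℓ ≡ 3 + (3 * m + 2 * ℓ)
        3*[1+m]+2ℓ = solve-∀

    manyRainbowStarts : ∀ m (Ds : Vector (ColDigraph n) m) →
                        (∀ t → Loopless (Ds t)) → (∀ t → Proper (Ds t)) → (∀ t → AlphaBound (Ds t) n d) →
                        3 * m + 2 * ℓ ≤ Δ →
                        Σ[ L ∈ RainbowStarts Ds ] n * d ≤ length (RainbowStarts.starts L) * d + m * (suc (Δ + Δ) * n)
    manyRainbowStarts zero Ds _ _ _ _ =
      trivialStarts Ds , ≤-reflexive (trans (cong (_* d) (sym (length-tabulate {n = n} (λ x → x)))) (sym (+-identityʳ _)))
    manyRainbowStarts (suc m) Ds loopless proper sparse Δ-bound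
      with manyRainbowStarts m (tail Ds) (loopless ∘ suc) (proper ∘ suc) (sparse ∘ suc) (≤-trans (n≤1+n _) (step-bound m Δ-bound))
    ... | L , L-large = extended , (begin
        n * d                                                         ≤⟨ L-large ⟩
        length (starts L) * d + m * K*n                               ≤⟨ +-monoˡ-≤ (m * K*n) (extended-large (loopless zero) (sparse zero) (step-bound m Δ-bound)) ⟩
        length (starts extended) * d + K*n + m * K*n                  ≡⟨ +-assoc (length (starts extended) * d) K*n (m * K*n) ⟩
        length (starts extended) * d + suc m * K*n                    ∎)
      where
        open ≤-Reasoning
        open RainbowStarts using (starts)
        open Extension restriction Ds (proper zero) L
        K*n = suc (Δ + Δ) * n

11*[1+k]²<100^[1+k] : ∀ k → 11 * (suc k * suc k) < 100 ^ suc k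
11*[1+k]²<100^[1+k] zero    = m≤m+n 12 88
11*[1+k]²<100^[1+k] (suc k) = begin-strict
  11 * (suc (suc k) * suc (suc k))    ≤⟨ *-monoʳ-≤ 11 (m≤m+n (suc (suc k) * suc (suc k)) (3 * (k * k) + 4 * k)) ⟩
  11 * (suc (suc k) * suc (suc k) + (3 * (k * k) + 4 * k))   ≡⟨ square-step k ⟩
  4 * (11 * (suc k * suc k))          <⟨ *-monoʳ-< 4 (11*[1+k]²<100^[1+k] k) ⟩
  4 * 100 ^ suc k                     ≤⟨ *-monoˡ-≤ (100 ^ suc k) (m≤m+n 4 96) ⟩
  100 ^ suc (suc k)                   ∎
  where
    open ≤-Reasoning
    square-step : ∀ k → 11 * ((2 + k) * (2 + k) + (3 * (k * k) + 4 * k)) ≡ 4 * (11 * ((1 + k) * (1 + k)))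
    square-step = solve-∀

k*[1+2[3k+2ℓ]]<100^k*ℓ² : ∀ k ℓ → 1 ≤ ℓ → k * suc ((3 * k + 2 * ℓ) + (3 * k + 2 * ℓ)) < 100 ^ k * (ℓ * ℓ)
k*[1+2[3k+2ℓ]]<100^k*ℓ² zero    (suc b) _ = s≤s z≤n
k*[1+2[3k+2ℓ]]<100^k*ℓ² (suc a) (suc b) _ = begin-strict
  k * suc ((3 * k + 2 * l) + (3 * k + 2 * l))   ≤⟨ ≤-trans (m≤m+n _ _) (≤-reflexive (polynomial-bound a b)) ⟩
  11 * (k * k) * (l * l)                        <⟨ *-monoˡ-< (l * l) (11*[1+k]²<100^[1+k] a) ⟩
  100 ^ k * (l * l)                             ∎
  where
    open ≤-Reasoning
    k = suc a
    l = suc b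
    -- the difference 11k²ℓ² - k(6k + 4ℓ + 1) at k = 1 + a, ℓ = 1 + b, expanded: all coefficients are ≥ 0
    polynomial-bound : ∀ a b →
      (1 + a) * suc ((3 * (1 + a) + 2 * (1 + b)) + (3 * (1 + a) + 2 * (1 + b)))
        + (18 * b + 11 * (b * b) + 5 * a + 40 * (a * b) + 22 * (a * (b * b)) + 5 * (a * a)
           + 22 * ((a * a) * b) + 11 * ((a * a) * (b * b)))
      ≡ 11 * ((1 + a) * (1 + a)) * ((1 + b) * (1 + b))
    polynomial-bound = solve-∀

∃∈-if-large : ∀ {a} {A : Set a} {xs : List A} {d b N : ℕ} → N ≤ length xs * d + b → b < N → ∃[ x ] x ∈ xs
∃∈-if-large {xs = []}    N≤b b<N = ⊥-elim (<⇒≱ b<N N≤b)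
∃∈-if-large {xs = x ∷ _} _   _   = x , here refl

properRainbowPath : ∀ {n k ℓ k'} {Sys : RDS n k ℓ} {k'≤k : k' ≤ k} {W : Walk n k'} →
                    RainbowPaths.IsRainbowPath (RDS.f Sys) (λ t → RDS.D Sys (inject≤ t k'≤k)) W →
                    ProperRainbowPath Sys k' k'≤k
properRainbowPath {W = W} path = record
  { vtx      = vertex W
  ; vtxDist  = vertex-injective
  ; col      = colour W
  ; arc      = arc
  ; colDist  = colour-injective
  ; avoidFst = avoidStart
  ; avoidLst = avoidEnd
  }
  where open RainbowPaths.IsRainbowPath path

lemma3p2 : (k k' ℓ n : ℕ) → 1 ≤ k' → (k'≤k : k' ≤ k) → 1 ≤ ℓ → 0 < n →
           (Sys : RDS n k ℓ) →
           ((i : Fin k') → AlphaBound (RDS.D Sys (inject≤ i k'≤k)) n ((100 ^ k') * (ℓ * ℓ))) →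
           ProperRainbowPath Sys k' k'≤k
lemma3p2 k k' ℓ n _ k'≤k 1≤ℓ 0<n Sys sparse = properRainbowPath (pathFrom-rainbow (proj₂ survivor))
  where
    open RDS Sys
    open RainbowPaths f
    d = 100 ^ k' * (ℓ * ℓ)
    Δ = 3 * k' + 2 * ℓ
    many = manyRainbowStarts fBounded {d} {Δ} k' (λ t → D (inject≤ t k'≤k))
             (loopless ∘ λ t → inject≤ t k'≤k) (proper ∘ λ t → inject≤ t k'≤k) sparse ≤-refl
    open RainbowStarts (proj₁ many)
    budget<n*d : k' * (suc (Δ + Δ) * n) < n * d
    budget<n*d = begin-strict
      k' * (suc (Δ + Δ) * n)   ≡⟨ *-assoc k' (suc (Δ + Δ)) n ⟨
      k' * suc (Δ + Δ) * n     <⟨ *-monoˡ-< n {{>-nonZero 0<n}} (k*[1+2[3k+2ℓ]]<100^k*ℓ² k' ℓ 1≤ℓ) ⟩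
      d * n                    ≡⟨ *-comm d n ⟩
      n * d                    ∎
      where open ≤-Reasoning
    survivor : ∃[ y ] y ∈ starts
    survivor = ∃∈-if-large (proj₂ many) budget<n*d
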